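{- Let $a$ and $k$ be positive integers. Then: (1) If $s$ is a positive integer with $s > k(\sqrt{a} + \sqrt{a+1})$, then $\tau_s(a) \geq k$; consequently $\tau_s(a) \to \infty$ as $s \to \infty$. (2) For every positive integer $s$, $\tau_{s+1}(a) - \tau_s(a) \in \{ -1, 0, 1\}$. (3) The first nonzero term of the sequence $(\tau_s(a))_{s \in \mathbb{Z}^+}$ equals $1$; that is, if $s$ is the least positive integer such that the open interval $(s^2 a, s^2(a+1))$ contains the square of an integer, then it contains exactly one such square of a positive integer.
   Context: For a positive integer $a$ and a positive integer $s$, let $T_s(a)$ be the set of all positive integers $t$ with $s^2 a < t^2 < s^2(a+1)$, and let $\tau_s(a) = |T_s(a)|$. -}

module Defs where

open import Data.Nat using (ℕ; suc; _+_; _*_; _∸_; _<_; _<?_)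
open import Data.Nat.Properties using ()
open import Data.List using (List; upTo; filter; length)
open import Data.Product using (_×_)
open import Relation.Nullary.Decidable using (_×-dec_)

InT : ℕ → ℕ → ℕ → Set
InT s a t = (s * s) * a < t * t × t * t < (s * s) * (a + 1)

-- Every t in T_s(a) satisfies t < s(a+1) + 1 (since t² < s²(a+1) ≤ (s(a+1))²),
-- so T_s(a) is the set of t in [0, s(a+1)] satisfying InT s a t
-- (t = 0 is never counted when s, a ≥ 1, since s²a < 0 fails).
T : ℕ → ℕ → List ℕ
T s a = filter (λ t → ((s * s) * a <? t * t) ×-dec (t * t <? (s * s) * (a + 1)))
               (upTo (suc (s * (a + 1))))

τ : ℕ → ℕ → ℕ
τ s a = length (T s a)

-- "s > k(√a + √(a+1))", stated without reals.  For naturals s, k, a with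
-- c := k²(2a+1):  s > √(k²a) + √(k²(a+1))  ⟺  s² > c + 2√(k⁴a(a+1))
--   ⟺  c < s²  and  4k⁴a(a+1) < (s² − c)².
SqrtSumBound : ℕ → ℕ → ℕ → Set
SqrtSumBound k a s =
  (k * k) * (2 * a + 1) < s * s ×
  4 * ((k * k) * (k * k)) * (a * (a + 1)) < (s * s ∸ (k * k) * (2 * a + 1)) * (s * s ∸ (k * k) * (2 * a + 1))

{-# OPTIONS --safe #-}
module Submission where

-- With u = ⌊s√a⌋ and v = ⌈s√(a+1)⌉ − 1, the set T_s(a) is the integer interval (u, v],
-- so τ_s(a) = v − u.  From s to s + 1 both endpoints move by ⌊√a⌋ or ⌊√a⌋ + 1, because
-- s√a + √a = √(s²a + 2sa + a) with sa an integer (and likewise for a + 1, noting that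
-- ⌈√(a+1)⌉ − 1 = ⌊√a⌋); hence τ changes by at most one.  Since a < t² < a + 1 is
-- impossible, τ_1(a) = 0, so the first nonzero value is 1.  For (1), the bound on s gives
-- (u + k)² < s²(a+1), i.e. u + k ≤ v.

open import Data.Empty using (⊥-elim)
open import Data.List using ([]; _∷_; [_]; _++_; filter; length; upTo)
open import Data.List.Properties using (upTo-∷ʳ; filter-++; length-++; filter-accept; filter-reject)
open import Data.Nat
open import Data.Nat.Properties
open import Data.Nat.Tactic.RingSolver using (solve)
open import Data.Product using (_×_; _,_; proj₁; proj₂; map₂; ∃-syntax)
open import Data.Sum using (_⊎_; inj₁; inj₂)
open import Function using (_∘_)
open import Relation.Nullary using (¬_; yes; no)
open import Relation.Nullary.Decidable using (_×-dec_)
open import Relation.Unary using (Decidable)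
open import Relation.Binary.PropositionalEquality
  using (_≡_; _≢_; refl; sym; trans; cong; subst; subst₂; module ≡-Reasoning)
open import Defs

module _ {P : ℕ → Set} (P? : Decidable P) where

  countBelow : ℕ → ℕ
  countBelow n = length (filter P? (upTo n))

  countBelow-suc : ∀ n → countBelow (suc n) ≡ countBelow n + length (filter P? [ n ])
  countBelow-suc n = begin
    length (filter P? (upTo (suc n)))               ≡⟨ cong (length ∘ filter P?) (upTo-∷ʳ n) ⟨
    length (filter P? (upTo n ++ [ n ]))            ≡⟨ cong length (filter-++ P? (upTo n) [ n ]) ⟩
    length (filter P? (upTo n) ++ filter P? [ n ])  ≡⟨ length-++ (filter P? (upTo n)) ⟩
    countBelow n + length (filter P? [ n ])         ∎
    where open ≡-Reasoning

  countBelow-suc-accept : ∀ {n} → P n → countBelow (suc n) ≡ suc (countBelow n)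
  countBelow-suc-accept {n} p = begin
    countBelow (suc n)                       ≡⟨ countBelow-suc n ⟩
    countBelow n + length (filter P? [ n ])
      ≡⟨ cong ((countBelow n +_) ∘ length) (filter-accept P? p) ⟩
    countBelow n + 1                         ≡⟨ +-comm (countBelow n) 1 ⟩
    suc (countBelow n)                       ∎
    where open ≡-Reasoning

  countBelow-suc-reject : ∀ {n} → ¬ P n → countBelow (suc n) ≡ countBelow n
  countBelow-suc-reject {n} ¬p = begin
    countBelow (suc n)                       ≡⟨ countBelow-suc n ⟩
    countBelow n + length (filter P? [ n ])
      ≡⟨ cong ((countBelow n +_) ∘ length) (filter-reject P? ¬p) ⟩
    countBelow n + 0                         ≡⟨ +-identityʳ (countBelow n) ⟩
    countBelow n                             ∎
    where open ≡-Reasoning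

  countBelow-accept : ∀ {m n} → m ≤ n → (∀ {t} → m ≤ t → t < n → P t) →
                      countBelow n ≡ (n ∸ m) + countBelow m
  countBelow-accept = accept-from ∘ ≤⇒≤′
    where
    accept-from : ∀ {m n} → m ≤′ n → (∀ {t} → m ≤ t → t < n → P t) →
                  countBelow n ≡ (n ∸ m) + countBelow m
    accept-from {m} ≤′-refl _ = cong (_+ countBelow m) (sym (n∸n≡0 m))
    accept-from {m} (≤′-step {n} m≤′n) accept = begin
      countBelow (suc n)              ≡⟨ countBelow-suc-accept (accept (≤′⇒≤ m≤′n) ≤-refl) ⟩
      suc (countBelow n)              ≡⟨ cong suc (accept-from m≤′n (λ m≤t → accept m≤t ∘ m<n⇒m<1+n)) ⟩
      suc (n ∸ m) + countBelow m      ≡⟨ cong (_+ countBelow m) (+-∸-assoc 1 (≤′⇒≤ m≤′n)) ⟨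
      (suc n ∸ m) + countBelow m      ∎
      where open ≡-Reasoning

  countBelow-reject : ∀ {m n} → m ≤ n → (∀ {t} → m ≤ t → t < n → ¬ P t) →
                      countBelow n ≡ countBelow m
  countBelow-reject = reject-from ∘ ≤⇒≤′
    where
    reject-from : ∀ {m n} → m ≤′ n → (∀ {t} → m ≤ t → t < n → ¬ P t) →
                  countBelow n ≡ countBelow m
    reject-from ≤′-refl _ = refl
    reject-from (≤′-step m≤′n) reject =
      trans (countBelow-suc-reject (reject (≤′⇒≤ m≤′n) ≤-refl))
            (reject-from m≤′n (λ m≤t → reject m≤t ∘ m<n⇒m<1+n))

  countBelow-interval : ∀ {lo hi N} → (∀ {t} → P t → lo < t × t ≤ hi) →
                        (∀ {t} → lo < t → t ≤ hi → P t) → lo ≤ hi → hi < N →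
                        countBelow N ≡ hi ∸ lo
  countBelow-interval {lo} {hi} {N} sound complete lo≤hi hi<N = begin
    countBelow N                     ≡⟨ countBelow-reject hi<N above ⟩
    countBelow (suc hi)              ≡⟨ countBelow-accept (s≤s lo≤hi) inside ⟩
    (hi ∸ lo) + countBelow (suc lo)  ≡⟨ cong ((hi ∸ lo) +_) (countBelow-reject z≤n below) ⟩
    (hi ∸ lo) + 0                    ≡⟨ +-identityʳ (hi ∸ lo) ⟩
    hi ∸ lo                          ∎
    where
    open ≡-Reasoning
    above : ∀ {t} → suc hi ≤ t → t < N → ¬ P t
    above hi<t _ p = <⇒≱ hi<t (proj₂ (sound p))
    inside : ∀ {t} → suc lo ≤ t → t < suc hi → P t
    inside lo<t t<1+hi = complete lo<t (s≤s⁻¹ t<1+hi)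
    below : ∀ {t} → 0 ≤ t → t < suc lo → ¬ P t
    below _ t<1+lo p = <⇒≱ (proj₁ (sound p)) (s≤s⁻¹ t<1+lo)

m*m≤n*n⇒m≤n : ∀ {m n} → m * m ≤ n * n → m ≤ n
m*m≤n*n⇒m≤n m²≤n² = ≮⇒≥ (λ n<m → <⇒≱ (*-mono-< n<m n<m) m²≤n²)

m*m<n*n⇒m<n : ∀ {m n} → m * m < n * n → m < n
m*m<n*n⇒m<n m²<n² = ≰⇒> (λ n≤m → <⇒≱ m²<n² (*-mono-≤ n≤m n≤m))

[m*n]²≡m²*n² : ∀ m n → (m * n) * (m * n) ≡ (m * m) * (n * n)
[m*n]²≡m²*n² m n = solve (m ∷ n ∷ [])

[m+n]²≡m²+2mn+n² : ∀ m n → (m + n) * (m + n) ≡ m * m + 2 * (m * n) + n * n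
[m+n]²≡m²+2mn+n² m n = solve (m ∷ n ∷ [])

≤∧≤suc⇒≡∨≡suc : ∀ {m n} → m ≤ n → n ≤ suc m → n ≡ m ⊎ n ≡ suc m
≤∧≤suc⇒≡∨≡suc m≤n n≤1+m with m≤n⇒m<n∨m≡n n≤1+m
... | inj₁ n<1+m = inj₁ (≤-antisym (s≤s⁻¹ n<1+m) m≤n)
... | inj₂ n≡1+m = inj₂ n≡1+m

record FloorSqrt (X r : ℕ) : Set where
  constructor mkFloorSqrt
  field
    sq≤ : r * r ≤ X
    <suc-sq : X < suc r * suc r

record StrictFloorSqrt (Y r : ℕ) : Set where
  constructor mkStrictFloorSqrt
  field
    sq< : r * r < Y
    ≤suc-sq : Y ≤ suc r * suc r

floorSqrt : ∀ X → ∃[ r ] FloorSqrt X r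
floorSqrt zero = 0 , mkFloorSqrt z≤n (s≤s z≤n)
floorSqrt (suc X) with floorSqrt X
... | r , mkFloorSqrt r²≤X X<[1+r]² with suc r * suc r ≤? suc X
...   | yes [1+r]²≤1+X =
  suc r , mkFloorSqrt [1+r]²≤1+X (≤-<-trans X<[1+r]² (*-mono-< (n<1+n (suc r)) (n<1+n (suc r))))
...   | no  [1+r]²≰1+X = r , mkFloorSqrt (m≤n⇒m≤1+n r²≤X) (≰⇒> [1+r]²≰1+X)

floorSqrt⇒strictFloorSqrt : ∀ {X r} → FloorSqrt X r → StrictFloorSqrt (suc X) r
floorSqrt⇒strictFloorSqrt (mkFloorSqrt r²≤X X<[1+r]²) = mkStrictFloorSqrt (s≤s r²≤X) X<[1+r]²

strictFloorSqrt : ∀ {Y} → 0 < Y → ∃[ r ] StrictFloorSqrt Y r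
strictFloorSqrt {suc Y} _ = map₂ floorSqrt⇒strictFloorSqrt (floorSqrt Y)

module _ {X r t : ℕ} (hr : FloorSqrt X r) where

  open FloorSqrt hr

  floorSqrt-sq≤⇒≤ : t * t ≤ X → t ≤ r
  floorSqrt-sq≤⇒≤ t²≤X = s≤s⁻¹ (m*m<n*n⇒m<n (≤-<-trans t²≤X <suc-sq))

  floorSqrt-<sq⇒< : X < t * t → r < t
  floorSqrt-<sq⇒< X<t² = m*m<n*n⇒m<n (≤-<-trans sq≤ X<t²)

  floorSqrt-<⇒<sq : r < t → X < t * t
  floorSqrt-<⇒<sq r<t = <-≤-trans <suc-sq (*-mono-≤ r<t r<t)

module _ {Y r t : ℕ} (hr : StrictFloorSqrt Y r) where

  open StrictFloorSqrt hr

  strictFloorSqrt-sq<⇒≤ : t * t < Y → t ≤ r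
  strictFloorSqrt-sq<⇒≤ t²<Y = s≤s⁻¹ (m*m<n*n⇒m<n (<-≤-trans t²<Y ≤suc-sq))

  strictFloorSqrt-≤sq⇒< : Y ≤ t * t → r < t
  strictFloorSqrt-≤sq⇒< Y≤t² = m*m<n*n⇒m<n (<-≤-trans sq< Y≤t²)

  strictFloorSqrt-≤⇒sq< : t ≤ r → t * t < Y
  strictFloorSqrt-≤⇒sq< t≤r = ≤-<-trans (*-mono-≤ t≤r t≤r) sq<

-- With AB = D² we have √A + √B = √(A + 2D + B).
module _ {A B D : ℕ} (AB≡D² : A * B ≡ D * D) where

  sq≤∧sq≤⇒*≤ : ∀ {x y} → x * x ≤ A → y * y ≤ B → x * y ≤ D
  sq≤∧sq≤⇒*≤ {x} {y} x²≤A y²≤B = m*m≤n*n⇒m≤n (begin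
    (x * y) * (x * y)  ≡⟨ [m*n]²≡m²*n² x y ⟩
    (x * x) * (y * y)  ≤⟨ *-mono-≤ x²≤A y²≤B ⟩
    A * B              ≡⟨ AB≡D² ⟩
    D * D              ∎)
    where open ≤-Reasoning

  ≤sq∧≤sq⇒≤* : ∀ {x y} → A ≤ x * x → B ≤ y * y → D ≤ x * y
  ≤sq∧≤sq⇒≤* {x} {y} A≤x² B≤y² = m*m≤n*n⇒m≤n (begin
    D * D              ≡⟨ AB≡D² ⟨
    A * B              ≤⟨ *-mono-≤ A≤x² B≤y² ⟩
    (x * x) * (y * y)  ≡⟨ [m*n]²≡m²*n² x y ⟨
    (x * y) * (x * y)  ∎)
    where open ≤-Reasoning

  floorSqrt-+ : ∀ {x y z} → FloorSqrt A x → FloorSqrt B y → FloorSqrt (A + 2 * D + B) z →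
                z ≡ x + y ⊎ z ≡ suc (x + y)
  floorSqrt-+ {x} {y} {z} (mkFloorSqrt x²≤A A<[1+x]²) (mkFloorSqrt y²≤B B<[1+y]²) hz =
    ≤∧≤suc⇒≡∨≡suc (floorSqrt-sq≤⇒≤ hz [x+y]²≤) z≤1+x+y
    where
    open ≤-Reasoning
    [x+y]²≤ : (x + y) * (x + y) ≤ A + 2 * D + B
    [x+y]²≤ = begin
      (x + y) * (x + y)            ≡⟨ [m+n]²≡m²+2mn+n² x y ⟩
      x * x + 2 * (x * y) + y * y
        ≤⟨ +-mono-≤ (+-mono-≤ x²≤A (*-monoʳ-≤ 2 (sq≤∧sq≤⇒*≤ {x} {y} x²≤A y²≤B))) y²≤B ⟩
      A + 2 * D + B                ∎
    <[2+x+y]² : A + 2 * D + B < (suc x + suc y) * (suc x + suc y)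
    <[2+x+y]² = begin-strict
      A + 2 * D + B
        <⟨ +-mono-< (+-mono-<-≤ A<[1+x]² (*-monoʳ-≤ 2 (≤sq∧≤sq⇒≤* {suc x} {suc y}
                                                         (<⇒≤ A<[1+x]²) (<⇒≤ B<[1+y]²))))
                    B<[1+y]² ⟩
      suc x * suc x + 2 * (suc x * suc y) + suc y * suc y  ≡⟨ [m+n]²≡m²+2mn+n² (suc x) (suc y) ⟨
      (suc x + suc y) * (suc x + suc y)                    ∎
    z≤1+x+y : z ≤ suc (x + y)
    z≤1+x+y = subst (z ≤_) (+-suc x y) (s≤s⁻¹ (floorSqrt-<sq⇒< hz <[2+x+y]²))

  strictFloorSqrt-+ : ∀ {x y z} → StrictFloorSqrt A x → StrictFloorSqrt B y →
                      StrictFloorSqrt (A + 2 * D + B) z → z ≡ x + y ⊎ z ≡ suc (x + y)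
  strictFloorSqrt-+ {x} {y} {z} (mkStrictFloorSqrt x²<A A≤[1+x]²)
                                (mkStrictFloorSqrt y²<B B≤[1+y]²) hz =
    ≤∧≤suc⇒≡∨≡suc (strictFloorSqrt-sq<⇒≤ hz [x+y]²<) z≤1+x+y
    where
    open ≤-Reasoning
    [x+y]²< : (x + y) * (x + y) < A + 2 * D + B
    [x+y]²< = begin-strict
      (x + y) * (x + y)            ≡⟨ [m+n]²≡m²+2mn+n² x y ⟩
      x * x + 2 * (x * y) + y * y
        <⟨ +-mono-< (+-mono-<-≤ x²<A (*-monoʳ-≤ 2 (sq≤∧sq≤⇒*≤ {x} {y} (<⇒≤ x²<A) (<⇒≤ y²<B)))) y²<B ⟩
      A + 2 * D + B                ∎
    ≤[2+x+y]² : A + 2 * D + B ≤ (suc x + suc y) * (suc x + suc y)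
    ≤[2+x+y]² = begin
      A + 2 * D + B
        ≤⟨ +-mono-≤ (+-mono-≤ A≤[1+x]² (*-monoʳ-≤ 2 (≤sq∧≤sq⇒≤* {suc x} {suc y} A≤[1+x]² B≤[1+y]²)))
                    B≤[1+y]² ⟩
      suc x * suc x + 2 * (suc x * suc y) + suc y * suc y  ≡⟨ [m+n]²≡m²+2mn+n² (suc x) (suc y) ⟨
      (suc x + suc y) * (suc x + suc y)                    ∎
    z≤1+x+y : z ≤ suc (x + y)
    z≤1+x+y = subst (z ≤_) (+-suc x y) (s≤s⁻¹ (strictFloorSqrt-≤sq⇒< hz ≤[2+x+y]²))

WithinOne : ℕ → ℕ → Set
WithinOne m n = m ≡ n ⊎ m ≡ suc n ⊎ suc m ≡ n

∸-withinOne : ∀ {u v u′ v′} → u′ ≤ v′ → u ≤ v → u′ ≡ u ⊎ u′ ≡ suc u → v′ ≡ v ⊎ v′ ≡ suc v →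
              WithinOne (v′ ∸ u′) (v ∸ u)
∸-withinOne _     _   (inj₁ refl) (inj₁ refl) = inj₁ refl
∸-withinOne _     u≤v (inj₁ refl) (inj₂ refl) = inj₂ (inj₁ (+-∸-assoc 1 u≤v))
∸-withinOne u′≤v′ _   (inj₂ refl) (inj₁ refl) = inj₂ (inj₂ (sym (+-∸-assoc 1 u′≤v′)))
∸-withinOne _     _   (inj₂ refl) (inj₂ refl) = inj₁ refl

withinOne-0 : ∀ {m} → WithinOne m 0 → m ≢ 0 → m ≡ 1
withinOne-0 (inj₁ m≡0)        m≢0 = ⊥-elim (m≢0 m≡0)
withinOne-0 (inj₂ (inj₁ m≡1)) _   = m≡1
withinOne-0 (inj₂ (inj₂ ()))  _

InT? : ∀ s a → Decidable (InT s a)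
InT? s a t = (s * s * a <? t * t) ×-dec (t * t <? s * s * (a + 1))

s²a<s²[a+1] : ∀ {s} a → 1 ≤ s → s * s * a < s * s * (a + 1)
s²a<s²[a+1] {suc s} a _ = *-monoʳ-< (suc s * suc s) (m<m+n a z<s)

strictFloorSqrt-s²[a+1] : ∀ s a → 1 ≤ s → ∃[ v ] StrictFloorSqrt (s * s * (a + 1)) v
strictFloorSqrt-s²[a+1] s a 1≤s = strictFloorSqrt (≤-<-trans z≤n (s²a<s²[a+1] a 1≤s))

module _ (s a : ℕ) {u v : ℕ} (1≤s : 1 ≤ s) (hu : FloorSqrt (s * s * a) u)
         (hv : StrictFloorSqrt (s * s * (a + 1)) v) where

  floorSqrt≤strictFloorSqrt : u ≤ v
  floorSqrt≤strictFloorSqrt =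
    strictFloorSqrt-sq<⇒≤ hv (≤-<-trans (FloorSqrt.sq≤ hu) (s²a<s²[a+1] a 1≤s))

  τ≡∸ : τ s a ≡ v ∸ u
  τ≡∸ = countBelow-interval (InT? s a) sound complete floorSqrt≤strictFloorSqrt v<N
    where
    sound : ∀ {t} → InT s a t → u < t × t ≤ v
    sound (s²a<t² , t²<s²[a+1]) = floorSqrt-<sq⇒< hu s²a<t² , strictFloorSqrt-sq<⇒≤ hv t²<s²[a+1]
    complete : ∀ {t} → u < t → t ≤ v → InT s a t
    complete u<t t≤v = floorSqrt-<⇒<sq hu u<t , strictFloorSqrt-≤⇒sq< hv t≤v
    v<N : v < suc (s * (a + 1))
    v<N = s≤s (<⇒≤ (strictFloorSqrt-≤sq⇒< hv (begin
      s * s * (a + 1)                          ≤⟨ m≤m+n (s * s * (a + 1)) (s * s * (a + 1) * a) ⟩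
      s * s * (a + 1) + s * s * (a + 1) * a    ≡⟨ solve (s ∷ a ∷ []) ⟩
      s * (a + 1) * (s * (a + 1))              ∎)))
      where open ≤-Reasoning

module _ {b : ℕ} (s : ℕ) where

  private
    b*s²b≡[sb]² : b * (s * s * b) ≡ (s * b) * (s * b)
    b*s²b≡[sb]² = solve (b ∷ s ∷ [])

    [1+s]²b≡b+2sb+s²b : suc s * suc s * b ≡ b + 2 * (s * b) + s * s * b
    [1+s]²b≡b+2sb+s²b = solve (b ∷ s ∷ [])

  floorSqrt-step : ∀ {q u u′} → FloorSqrt b q → FloorSqrt (s * s * b) u →
                   FloorSqrt (suc s * suc s * b) u′ → u′ ≡ q + u ⊎ u′ ≡ suc (q + u)
  floorSqrt-step {u′ = u′} hq hu hu′ =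
    floorSqrt-+ {D = s * b} b*s²b≡[sb]² hq hu
      (subst (λ X → FloorSqrt X u′) [1+s]²b≡b+2sb+s²b hu′)

  strictFloorSqrt-step : ∀ {q v v′} → StrictFloorSqrt b q → StrictFloorSqrt (s * s * b) v →
                         StrictFloorSqrt (suc s * suc s * b) v′ → v′ ≡ q + v ⊎ v′ ≡ suc (q + v)
  strictFloorSqrt-step {v′ = v′} hq hv hv′ =
    strictFloorSqrt-+ {D = s * b} b*s²b≡[sb]² hq hv
      (subst (λ Y → StrictFloorSqrt Y v′) [1+s]²b≡b+2sb+s²b hv′)

τ-suc-withinOne : ∀ a s → 1 ≤ s → WithinOne (τ (suc s) a) (τ s a)
τ-suc-withinOne a s 1≤s
  with floorSqrt a | floorSqrt (s * s * a) | strictFloorSqrt-s²[a+1] s a 1≤s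
     | floorSqrt (suc s * suc s * a) | strictFloorSqrt-s²[a+1] (suc s) a (s≤s z≤n)
... | q , hq | u , hu | v , hv | u′ , hu′ | v′ , hv′ =
  subst₂ WithinOne (sym (τ≡∸ (suc s) a (s≤s z≤n) hu′ hv′)) (sym (τ≡∸ s a 1≤s hu hv))
    (subst (WithinOne (v′ ∸ u′)) ([m+n]∸[m+o]≡n∸o q v u)
      (∸-withinOne (floorSqrt≤strictFloorSqrt (suc s) a (s≤s z≤n) hu′ hv′)
                   (+-monoʳ-≤ q (floorSqrt≤strictFloorSqrt s a 1≤s hu hv))
                   (floorSqrt-step s hq hu hu′)
                   (strictFloorSqrt-step s hq′ hv hv′)))
  where
  hq′ : StrictFloorSqrt (a + 1) q
  hq′ = subst (λ Y → StrictFloorSqrt Y q) (+-comm 1 a) (floorSqrt⇒strictFloorSqrt hq)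

τ-1 : ∀ a → τ 1 a ≡ 0
τ-1 a = countBelow-reject (InT? 1 a) {n = suc (1 * (a + 1))} z≤n (λ {t} _ _ → no-square-between {t})
  where
  no-square-between : ∀ {t} → ¬ InT 1 a t
  no-square-between {t} (a<t² , t²<a+1) =
    <⇒≱ a<t² (s≤s⁻¹ (subst (t * t <_) 1²[a+1]≡1+1²a t²<a+1))
    where
    1²[a+1]≡1+1²a : 1 * 1 * (a + 1) ≡ suc (1 * 1 * a)
    1²[a+1]≡1+1²a = solve (a ∷ [])

firstNonzero-τ≡1 : ∀ {a s} → 1 ≤ s → τ s a ≢ 0 → (∀ r → 1 ≤ r → r < s → τ r a ≡ 0) → τ s a ≡ 1
firstNonzero-τ≡1 {a} {suc zero}    _ τ≢0 _       = ⊥-elim (τ≢0 (τ-1 a))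
firstNonzero-τ≡1 {a} {suc (suc r)} _ τ≢0 earlier =
  withinOne-0 (subst (WithinOne _) (earlier (suc r) (s≤s z≤n) ≤-refl)
                     (τ-suc-withinOne a (suc r) (s≤s z≤n)))
              τ≢0

module _ (k a : ℕ) where

  gap⇒[k+u]²<S[a+1] : ∀ {S Y u} → S ≡ Y + k * k * (2 * a + 1) →
                      4 * (k * k * (k * k)) * (a * (a + 1)) < Y * Y →
                      u * u ≤ S * a → (k + u) * (k + u) < S * (a + 1)
  gap⇒[k+u]²<S[a+1] {Y = Y} {u} refl gap u²≤Sa = begin-strict
    (k + u) * (k + u)                                  ≡⟨ solve (k ∷ u ∷ []) ⟩
    u * u + (2 * (k * u) + k * k)                      <⟨ +-mono-≤-< u²≤Sa (+-monoˡ-< (k * k) 2ku<X) ⟩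
    (Y + k * k * (2 * a + 1)) * a + (Y + 2 * (k * k * a) + k * k)
                                                       ≡⟨ solve (Y ∷ k ∷ a ∷ []) ⟩
    (Y + k * k * (2 * a + 1)) * (a + 1)                ∎
    where
    open ≤-Reasoning
    2ku<X : 2 * (k * u) < Y + 2 * (k * k * a)
    2ku<X = m*m<n*n⇒m<n (begin-strict
      2 * (k * u) * (2 * (k * u))                      ≡⟨ solve (k ∷ u ∷ []) ⟩
      4 * (k * k) * (u * u)                            ≤⟨ *-monoʳ-≤ (4 * (k * k)) u²≤Sa ⟩
      4 * (k * k) * ((Y + k * k * (2 * a + 1)) * a)    ≡⟨ solve (Y ∷ k ∷ a ∷ []) ⟩
      4 * (k * k * (k * k)) * (a * (a + 1)) + (4 * (k * k * a) * Y + 4 * (k * k * a) * (k * k * a))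
                                                       <⟨ +-monoˡ-< _ gap ⟩
      Y * Y + (4 * (k * k * a) * Y + 4 * (k * k * a) * (k * k * a))
                                                       ≡⟨ solve (Y ∷ k ∷ a ∷ []) ⟩
      (Y + 2 * (k * k * a)) * (Y + 2 * (k * k * a))    ∎)

  sqrtSumBound⇒[k+u]²<s²[a+1] : ∀ {s u} → SqrtSumBound k a s → u * u ≤ s * s * a →
                                (k + u) * (k + u) < s * s * (a + 1)
  sqrtSumBound⇒[k+u]²<s²[a+1] (c<s² , gap) = gap⇒[k+u]²<S[a+1] (sym (m∸n+n≡m (<⇒≤ c<s²))) gap

  sqrtSumBound-large : ∀ s → 2 * (k * k * (a + 1)) + k * k * (2 * a + 1) < s → SqrtSumBound k a s
  sqrtSumBound-large s@(suc _) D+c<s = c<s² , gap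
    where
    open ≤-Reasoning
    D = 2 * (k * k * (a + 1))
    c = k * k * (2 * a + 1)
    D+c<s² : D + c < s * s
    D+c<s² = <-≤-trans D+c<s (m≤m*n s s)
    c<s² : c < s * s
    c<s² = ≤-<-trans (m≤n+m c D) D+c<s²
    D<s²∸c : D < s * s ∸ c
    D<s²∸c = m+n≤o⇒m≤o∸n (suc D) D+c<s²
    gap : 4 * (k * k * (k * k)) * (a * (a + 1)) < (s * s ∸ c) * (s * s ∸ c)
    gap = begin-strict
      4 * (k * k * (k * k)) * (a * (a + 1))
        ≤⟨ *-monoʳ-≤ (4 * (k * k * (k * k))) (*-monoˡ-≤ (a + 1) (m≤m+n a 1)) ⟩
      4 * (k * k * (k * k)) * ((a + 1) * (a + 1))
        ≡⟨ solve (k ∷ a ∷ []) ⟩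
      2 * (k * k * (a + 1)) * (2 * (k * k * (a + 1)))
        <⟨ *-mono-< D<s²∸c D<s²∸c ⟩
      (s * s ∸ c) * (s * s ∸ c) ∎

sqrtSumBound⇒k≤τ : ∀ {k a s} → 1 ≤ s → SqrtSumBound k a s → k ≤ τ s a
sqrtSumBound⇒k≤τ {k} {a} {s} 1≤s bound with floorSqrt (s * s * a) | strictFloorSqrt-s²[a+1] s a 1≤s
... | u , hu | v , hv =
  subst (k ≤_) (sym (τ≡∸ s a 1≤s hu hv))
    (m+n≤o⇒m≤o∸n k {u} (strictFloorSqrt-sq<⇒≤ hv
      (sqrtSumBound⇒[k+u]²<s²[a+1] k a {s} bound (FloorSqrt.sq≤ hu))))

τ-unbounded : ∀ a k → ∃[ N ] (∀ s → N ≤ s → k ≤ τ s a)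
τ-unbounded a k = suc (2 * (k * k * (a + 1)) + k * k * (2 * a + 1)) , λ s N≤s →
  sqrtSumBound⇒k≤τ (≤-trans (s≤s z≤n) N≤s) (sqrtSumBound-large k a s N≤s)

theorem1 : (a : ℕ) → 1 ≤ a →
    -- (1) the bound, and its consequence τ_s(a) → ∞
    ((k : ℕ) → 1 ≤ k → (s : ℕ) → 1 ≤ s → SqrtSumBound k a s → k ≤ τ s a)
    × ((k : ℕ) → ∃[ N ] ((s : ℕ) → N ≤ s → k ≤ τ s a))
    -- (2) consecutive differences lie in minus-one, zero, one
    × ((s : ℕ) → 1 ≤ s →
        (τ (suc s) a ≡ τ s a ⊎ τ (suc s) a ≡ suc (τ s a) ⊎ suc (τ (suc s) a) ≡ τ s a))
    -- (3) the first nonzero term equals 1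
    × ((s : ℕ) → 1 ≤ s → τ s a ≢ 0 →
        ((r : ℕ) → 1 ≤ r → r < s → τ r a ≡ 0) → τ s a ≡ 1)
theorem1 a _ =
    (λ _ _ _ → sqrtSumBound⇒k≤τ)
  , τ-unbounded a
  , τ-suc-withinOne a
  , (λ _ → firstNonzero-τ≡1)
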